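{- For all integers $n,m\ge 2$, \[ \min\{n,m\}+2\le \gamma_{2t}(K_n\Box K_m)\le 2\min\{n,m\}. \]
   Context: All graphs are finite, simple and undirected. $K_n$ denotes the complete graph on $n$ vertices. The Cartesian product $G\Box H$ of graphs $G,H$ has vertex set $V(G)\times V(H)$, with $(u_1,v_1)\sim(u_2,v_2)$ iff either $u_1=u_2$ and $v_1\sim v_2$ in $H$, or $v_1=v_2$ and $u_1\sim u_2$ in $G$. A set $S\subseteq V(G)$ is a total $2$-dominating set of $G$ if every vertex of $G$ (including those in $S$) is adjacent to at least two vertices of $S$; the total $2$-domination number $\gamma_{2t}(G)$ is the minimum cardinality of a total $2$-dominating set of $G$. -}

module Defs where

open import Level using (Level; _⊔_; suc)
open import Data.Nat using (ℕ; _≤_)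
open import Data.Fin using (Fin)
open import Data.Product using (_×_; _,_; Σ; ∃-syntax)
open import Data.List using (List; length)
open import Data.List.Membership.Propositional using (_∈_)
open import Data.List.Relation.Unary.Unique.Propositional using (Unique)
open import Relation.Binary.PropositionalEquality using (_≡_; _≢_)
open import Data.Sum using (_⊎_)

record Graph (V : Set) : Set₁ where
  field
    Adj : V → V → Set

open Graph public

K : (n : ℕ) → Graph (Fin n)
Adj (K n) i j = i ≢ j

_□_ : {V W : Set} → Graph V → Graph W → Graph (V × W)
Adj (G □ H) (u₁ , v₁) (u₂ , v₂) =
  (u₁ ≡ u₂ × Adj H v₁ v₂) ⊎ (v₁ ≡ v₂ × Adj G u₁ u₂)

record VSet (V : Set) : Set where
  constructor vset
  field
    elems  : List V
    unique : Unique elems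

open VSet public

card : {V : Set} → VSet V → ℕ
card S = length (elems S)

IsTotal2Dom : {V : Set} → Graph V → VSet V → Set
IsTotal2Dom {V} G S =
  (v : V) → ∃[ a ] ∃[ b ] (a ∈ elems S × b ∈ elems S × a ≢ b × Adj G v a × Adj G v b)

IsTotal2DomNumber : {V : Set} → Graph V → ℕ → Set
IsTotal2DomNumber {V} G k =
  (∃[ S ] (IsTotal2Dom G S × card S ≡ k)) ×
  ((S : VSet V) → IsTotal2Dom G S → k ≤ card S)

-- Upper bound: for n ≤ m the 2n cells of two columns form a total 2-dominating set (symmetrically,
-- two rows for m ≤ n).  Lower bound for a total 2-dominating set S: if every row contains two cells of S
-- then |S| ≥ 2n.  Otherwise some row r contains at most one cell of S.  If it contains none, each
-- cell (r, c) is dominated from inside column c, so every column holds two cells of S and |S| ≥ 2m.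
-- If it contains exactly one cell x₀, the two S-neighbours of x₀ lie in the column of x₀, and for every
-- other column c the cell (r, c) has an S-neighbour other than x₀, which must lie in column c.  With x₀
-- and its two neighbours these are m + 2 distinct cells of S.
module Submission where

open import Defs
open import Data.Nat using (ℕ; s≤s; _≤_; _<_; _+_; _*_; _⊓_; _≤?_)
open import Data.Nat.Properties
  using ( ≤-refl; ≤-trans; ≤-antisym; ≮⇒≥; ≰⇒≥; +-comm; +-identityʳ; +-monoˡ-≤; +-monoʳ-≤
        ; m⊓n≤m; m⊓n≤n; m≤n⇒m⊓n≡m; m≥n⇒m⊓n≡n; anyUpTo?; module ≤-Reasoning)
open import Data.Nat.Induction using (<-rec)
open import Data.Fin using (Fin; zero; suc; punchIn) renaming (_≟_ to _≟ᶠ_)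
open import Data.Fin.Properties using (injective⇒≤; all?; ¬∀⟶∃¬; punchInᵢ≢i)
open import Data.Product using (_×_; _,_; proj₁; proj₂; ∃-syntax; swap)
open import Data.Product.Properties using (≡-dec)
open import Data.Sum using (_⊎_; inj₁; inj₂)
import Data.Sum as Sum
open import Data.Empty using (⊥-elim)
open import Data.List
  using (List; []; _∷_; _++_; length; lookup; tabulate; map; filter; allFin; cartesianProduct)
open import Data.List.Properties using (length-++; length-tabulate; length-map)
open import Data.List.Membership.Propositional using (_∈_; find; lose)
open import Data.List.Membership.Propositional.Properties
  using ( ∈-lookup; ∈-tabulate⁺; ∈-tabulate⁻; ∈-++⁺ˡ; ∈-++⁺ʳ; ∈-++⁻; ∈-map⁺; ∈-filter⁺; ∈-filter⁻
        ; ∈-allFin; ∈-cartesianProduct⁺)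
open import Data.List.Relation.Unary.Any using (Any; any?; index; here; there)
open import Data.List.Relation.Unary.Any.Properties using (lookup-index)
open import Data.List.Relation.Unary.All using (_∷_)
import Data.List.Relation.Unary.All as All
open import Data.List.Relation.Unary.All.Properties using () renaming (tabulate⁺ to All-tabulate⁺)
open import Data.List.Relation.Unary.Unique.Propositional using (Unique; []; _∷_)
import Data.List.Relation.Unary.Unique.Propositional.Properties as Unique
open import Data.List.Relation.Binary.Sublist.Propositional using (_⊆_; []; _∷_; _∷ʳ_)
open import Data.List.Relation.Binary.Sublist.Propositional.Properties using (All-resp-⊆; filter-⊆)
open import Data.List.Relation.Binary.Disjoint.Propositional using (Disjoint)
open import Function using (Injective; _∘_)
open import Relation.Binary.Definitions using (DecidableEquality)
open import Relation.Binary.PropositionalEquality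
  using (_≡_; _≢_; refl; sym; trans; cong; cong₂; subst; module ≡-Reasoning)
open import Relation.Nullary using (Dec; yes; no; ¬_; map′; ¬?; _×-dec_; _⊎-dec_)
open import Relation.Unary using (Decidable)

module _ {A : Set} where

  index-injective : ∀ {x y} {xs : List A} (p : x ∈ xs) (q : y ∈ xs) → index p ≡ index q → x ≡ y
  index-injective {xs = xs} p q eq =
    trans (lookup-index p) (trans (cong (lookup xs) eq) (sym (lookup-index q)))

  unique⇒lookup-injective : {xs : List A} → Unique xs → Injective _≡_ _≡_ (lookup xs)
  unique⇒lookup-injective (_ ∷ _)  {zero}  {zero}  _  = refl
  unique⇒lookup-injective (x≢ ∷ _) {zero}  {suc j} eq = ⊥-elim (All.lookup x≢ (∈-lookup j) eq)
  unique⇒lookup-injective (x≢ ∷ _) {suc i} {zero}  eq = ⊥-elim (All.lookup x≢ (∈-lookup i) (sym eq))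
  unique⇒lookup-injective (_ ∷ u)  {suc i} {suc j} eq = cong suc (unique⇒lookup-injective u eq)

  unique-⊆⇒length≤ : {xs ys : List A} → Unique xs → (∀ {z} → z ∈ xs → z ∈ ys) → length xs ≤ length ys
  unique-⊆⇒length≤ u xs⊆ys = injective⇒≤ λ eq →
    unique⇒lookup-injective u (index-injective (xs⊆ys (∈-lookup _)) (xs⊆ys (∈-lookup _)) eq)

  unique-tabulate++tabulate : ∀ {k l} {p : Fin k → A} {q : Fin l → A} →
    Injective _≡_ _≡_ p → Injective _≡_ _≡_ q → (∀ i j → p i ≢ q j) → Unique (tabulate p ++ tabulate q)
  unique-tabulate++tabulate {p = p} {q} p-inj q-inj p≢q =
    Unique.++⁺ (Unique.tabulate⁺ p-inj) (Unique.tabulate⁺ q-inj) disjoint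
    where
    disjoint : Disjoint (tabulate p) (tabulate q)
    disjoint (z∈p , z∈q) with ∈-tabulate⁻ z∈p | ∈-tabulate⁻ z∈q
    ... | i , refl | j , eq = p≢q i j eq

  length-tabulate++tabulate : ∀ {k l} (p : Fin k → A) (q : Fin l → A) →
    length (tabulate p ++ tabulate q) ≡ k + l
  length-tabulate++tabulate p q =
    trans (length-++ (tabulate p)) (cong₂ _+_ (length-tabulate p) (length-tabulate q))

  Unique-resp-⊇ : {xs ys : List A} → xs ⊆ ys → Unique ys → Unique xs
  Unique-resp-⊇ []         []       = []
  Unique-resp-⊇ (_ ∷ʳ τ)   (_ ∷ u)  = Unique-resp-⊇ τ u
  Unique-resp-⊇ (refl ∷ τ) (y≢ ∷ u) = All-resp-⊆ τ y≢ ∷ Unique-resp-⊇ τ u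

  anySublist? : {P : List A → Set} → Decidable P → ∀ xs → Dec (∃[ ys ] (ys ⊆ xs × P ys))
  anySublist? P? [] = map′ (λ p → [] , [] , p) (λ { (.[] , [] , p) → p }) (P? [])
  anySublist? P? (x ∷ xs) with anySublist? (λ ys → P? (x ∷ ys)) xs | anySublist? P? xs
  ... | yes (ys , τ , p) | _                = yes (x ∷ ys , refl ∷ τ , p)
  ... | no _             | yes (ys , τ , p) = yes (ys , x ∷ʳ τ , p)
  ... | no ¬kept         | no ¬skipped      = no λ where
    (_ , refl ∷ τ , p) → ¬kept (_ , τ , p)
    (_ , _ ∷ʳ τ , p)   → ¬skipped (_ , τ , p)

  TwoDistinctIn : List A → (A → Set) → Set
  TwoDistinctIn xs P = ∃[ a ] ∃[ b ] (a ∈ xs × b ∈ xs × a ≢ b × P a × P b)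

  twoPerClass⇒≤length : ∀ {k} {xs : List A} (key : A → Fin k) →
    (∀ i → TwoDistinctIn xs (λ a → key a ≡ i)) → k + k ≤ length xs
  twoPerClass⇒≤length {k} {xs} key two =
    subst (_≤ length xs) (length-tabulate++tabulate first second) (unique-⊆⇒length≤ pairs-unique pairs⊆xs)
    where
    first second : Fin k → A
    first i = proj₁ (two i)
    second i = proj₁ (proj₂ (two i))

    facts : ∀ i → first i ∈ xs × second i ∈ xs × first i ≢ second i ×
                  key (first i) ≡ i × key (second i) ≡ i
    facts i = proj₂ (proj₂ (two i))

    key-first : ∀ i → key (first i) ≡ i
    key-first i = let (_ , _ , _ , kf , _) = facts i in kf

    key-second : ∀ i → key (second i) ≡ i
    key-second i = let (_ , _ , _ , _ , ks) = facts i in ks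

    key-injective : ∀ {p q : Fin k → A} → (∀ i → key (p i) ≡ i) → (∀ i → key (q i) ≡ i) →
      ∀ {i j} → p i ≡ q j → i ≡ j
    key-injective kp kq {i} {j} eq = trans (sym (kp i)) (trans (cong key eq) (kq j))

    first≢second : ∀ i j → first i ≢ second j
    first≢second i j eq with key-injective key-first key-second eq
    ... | refl = let (_ , _ , f≢s , _) = facts i in f≢s eq

    pairs-unique : Unique (tabulate first ++ tabulate second)
    pairs-unique = unique-tabulate++tabulate
      (key-injective key-first key-first) (key-injective key-second key-second) first≢second

    pairs⊆xs : ∀ {z} → z ∈ tabulate first ++ tabulate second → z ∈ xs
    pairs⊆xs z∈ with ∈-++⁻ (tabulate first) z∈
    ... | inj₁ z∈first with ∈-tabulate⁻ z∈first
    ...   | i , refl = proj₁ (facts i)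
    pairs⊆xs z∈ | inj₂ z∈second with ∈-tabulate⁻ z∈second
    ...   | i , refl = proj₁ (proj₂ (facts i))

module _ {A : Set} (_≟_ : DecidableEquality A) where

  twoDistinctIn? : {P : A → Set} → Decidable P → ∀ xs → Dec (TwoDistinctIn xs P)
  twoDistinctIn? {P} P? xs =
    map′ fromAny toAny (any? (λ a → any? (λ b → ¬? (a ≟ b) ×-dec P? a ×-dec P? b) xs) xs)
    where
    fromAny : Any (λ a → Any (λ b → a ≢ b × P a × P b) xs) xs → TwoDistinctIn xs P
    fromAny any with find any
    ... | a , a∈ , anyb with find anyb
    ...   | b , b∈ , props = a , b , a∈ , b∈ , props

    toAny : TwoDistinctIn xs P → Any (λ a → Any (λ b → a ≢ b × P a × P b) xs) xs
    toAny (a , b , a∈ , b∈ , props) = lose a∈ (lose b∈ props)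

  twoDistinct⇒avoiding : ∀ {xs} {P : A → Set} → TwoDistinctIn xs P → ∀ x → ∃[ z ] (z ∈ xs × P z × z ≢ x)
  twoDistinct⇒avoiding (a , b , a∈ , b∈ , a≢b , pa , pb) x with a ≟ x
  ... | yes refl = b , b∈ , pb , a≢b ∘ sym
  ... | no a≢x   = a , a∈ , pa , a≢x

IsLeast : (ℕ → Set) → ℕ → Set
IsLeast Q k = Q k × ∀ j → Q j → k ≤ j

least-witness : {Q : ℕ → Set} → Decidable Q → ∀ {c} → Q c → ∃[ k ] IsLeast Q k
least-witness {Q} Q? {c} = <-rec (λ c → Q c → ∃[ k ] IsLeast Q k) search c
  where
  search : ∀ c → (∀ {j} → j < c → Q j → ∃[ k ] IsLeast Q k) → Q c → ∃[ k ] IsLeast Q k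
  search c below qc with anyUpTo? Q? c
  ... | yes (j , j<c , qj) = below j<c qj
  ... | no none = c , qc , λ j qj → ≮⇒≥ (λ j<c → none (j , j<c , qj))

module FiniteGraph
  {V : Set} (_≟_ : DecidableEquality V) (G : Graph V) (adj? : ∀ u → Decidable (Adj G u))
  (vertices : List V) (vertices-unique : Unique vertices) (vertices-complete : ∀ v → v ∈ vertices)
  where

  open import Data.List.Membership.DecPropositional _≟_ using (_∈?_)

  Total2Dominating : List V → Set
  Total2Dominating xs = ∀ v → TwoDistinctIn xs (Adj G v)

  total2Dominating? : Decidable Total2Dominating
  total2Dominating? xs =
    map′ (λ all v → All.lookup all (vertices-complete v)) (λ dom → All.tabulate (λ {v} _ → dom v))
         (All.all? (λ v → twoDistinctIn? _≟_ (adj? v) xs) vertices)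

  HasTotal2DomSetOfSize≤ : ℕ → Set
  HasTotal2DomSetOfSize≤ j = ∃[ S ] (IsTotal2Dom G S × card S ≤ j)

  -- Restricting the vertex list to S keeps it 2-dominating and no longer, so it suffices to search sublists.
  hasTotal2DomSetOfSize≤? : Decidable HasTotal2DomSetOfSize≤
  hasTotal2DomSetOfSize≤? j =
    map′ fromSublist toSublist (anySublist? (λ ys → total2Dominating? ys ×-dec (length ys ≤? j)) vertices)
    where
    fromSublist : ∃[ ys ] (ys ⊆ vertices × Total2Dominating ys × length ys ≤ j) → HasTotal2DomSetOfSize≤ j
    fromSublist (ys , ys⊆ , dom , len) = vset ys (Unique-resp-⊇ ys⊆ vertices-unique) , dom , len

    toSublist : HasTotal2DomSetOfSize≤ j → ∃[ ys ] (ys ⊆ vertices × Total2Dominating ys × length ys ≤ j)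
    toSublist (S , dom , len) = ys , filter-⊆ (_∈? elems S) vertices , ys-dom , ≤-trans ys≤S len
      where
      ys : List V
      ys = filter (_∈? elems S) vertices

      ys-dom : Total2Dominating ys
      ys-dom v with dom v
      ... | a , b , a∈ , b∈ , props =
        a , b , ∈-filter⁺ (_∈? elems S) (vertices-complete a) a∈ ,
        ∈-filter⁺ (_∈? elems S) (vertices-complete b) b∈ , props

      ys≤S : length ys ≤ card S
      ys≤S = unique-⊆⇒length≤ (Unique.filter⁺ (_∈? elems S) vertices-unique)
        (λ z∈ → proj₂ (∈-filter⁻ (_∈? elems S) {xs = vertices} z∈))

  total2DomNumber-exists : (S : VSet V) → IsTotal2Dom G S → ∃[ k ] IsTotal2DomNumber G k
  total2DomNumber-exists S dom with least-witness hasTotal2DomSetOfSize≤? (S , dom , ≤-refl)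
  ... | k , (T , domT , T≤k) , least =
    k , (T , domT , ≤-antisym T≤k (least (card T) (T , domT , ≤-refl))) ,
    λ S′ domS′ → least (card S′) (S′ , domS′ , ≤-refl)

swapVSet : ∀ {V W} → VSet (V × W) → VSet (W × V)
swapVSet S = vset (map swap (elems S)) (Unique.map⁺ (cong swap) (unique S))

IsTotal2Dom-swap : ∀ {V W} (G : Graph V) (H : Graph W) S →
  IsTotal2Dom (G □ H) S → IsTotal2Dom (H □ G) (swapVSet S)
IsTotal2Dom-swap G H S dom (w , v) with dom (v , w)
... | a , b , a∈ , b∈ , a≢b , va , vb =
  swap a , swap b , ∈-map⁺ swap a∈ , ∈-map⁺ swap b∈ , (λ eq → a≢b (cong swap eq)) ,
  Sum.swap va , Sum.swap vb

□-adj-offRow : ∀ {V W} (G : Graph V) (H : Graph W) {u u′ v v′} →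
  u ≢ u′ → Adj (G □ H) (u , v) (u′ , v′) → v ≡ v′
□-adj-offRow G H u≢u′ (inj₁ (u≡u′ , _)) = ⊥-elim (u≢u′ u≡u′)
□-adj-offRow G H u≢u′ (inj₂ (v≡v′ , _)) = v≡v′

module Rook (n m : ℕ) where

  Cell : Set
  Cell = Fin n × Fin m

  row : Cell → Fin n
  row = proj₁

  col : Cell → Fin m
  col = proj₂

  _≟_ : DecidableEquality Cell
  _≟_ = ≡-dec _≟ᶠ_ _≟ᶠ_

  adj? : ∀ x y → Dec (Adj (K n □ K m) x y)
  adj? (r , c) (r′ , c′) = ((r ≟ᶠ r′) ×-dec ¬? (c ≟ᶠ c′)) ⊎-dec ((c ≟ᶠ c′) ×-dec ¬? (r ≟ᶠ r′))

  adj-irreflexive : ∀ x → ¬ Adj (K n □ K m) x x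
  adj-irreflexive x (inj₁ (_ , c≢c)) = c≢c refl
  adj-irreflexive x (inj₂ (_ , r≢r)) = r≢r refl

  offRow⇒sameCol : ∀ {x z} → row x ≢ row z → Adj (K n □ K m) x z → col x ≡ col z
  offRow⇒sameCol = □-adj-offRow (K n) (K m)

  open FiniteGraph _≟_ (K n □ K m) adj? (cartesianProduct (allFin n) (allFin m))
    (Unique.cartesianProduct⁺ (Unique.allFin⁺ n) (Unique.allFin⁺ m))
    (λ (r , c) → ∈-cartesianProduct⁺ (∈-allFin r) (∈-allFin c))
    public using (total2DomNumber-exists)

  module LowerBound (S : VSet Cell) (dom : IsTotal2Dom (K n □ K m) S) where

    emptyRow⇒m+m≤card : ∀ r → (∀ {y} → y ∈ elems S → row y ≢ r) → m + m ≤ card S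
    emptyRow⇒m+m≤card r empty = twoPerClass⇒≤length col twoInColumn
      where
      twoInColumn : ∀ c → TwoDistinctIn (elems S) (λ y → col y ≡ c)
      twoInColumn c with dom (r , c)
      ... | a , b , a∈ , b∈ , a≢b , adj-a , adj-b =
        a , b , a∈ , b∈ , a≢b ,
        sym (offRow⇒sameCol (λ eq → empty a∈ (sym eq)) adj-a) ,
        sym (offRow⇒sameCol (λ eq → empty b∈ (sym eq)) adj-b)

    singletonRow⇒2+m≤card : ∀ {r x₀} → x₀ ∈ elems S → row x₀ ≡ r →
      (∀ {y} → y ∈ elems S → row y ≡ r → y ≡ x₀) → 2 + m ≤ card S
    singletonRow⇒2+m≤card {x₀ = x₀} x₀∈ refl only-x₀ with dom x₀
    ... | a , b , a∈ , b∈ , a≢b , adj-a , adj-b =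
      subst (_≤ card S) (cong (2 +_) (length-tabulate rep)) (unique-⊆⇒length≤ cells-unique cells⊆S)
      where
      offRow : ∀ {z} → z ∈ elems S → z ≢ x₀ → row x₀ ≢ row z
      offRow z∈ z≢x₀ eq = z≢x₀ (only-x₀ z∈ (sym eq))

      neighbour-inColumn : ∀ {z} → z ∈ elems S → Adj (K n □ K m) x₀ z → z ≢ x₀ × col z ≡ col x₀
      neighbour-inColumn {z} z∈ adj = z≢x₀ , sym (offRow⇒sameCol (offRow z∈ z≢x₀) adj)
        where
        z≢x₀ : z ≢ x₀
        z≢x₀ refl = adj-irreflexive x₀ adj

      columnRep : ∀ c → ∃[ z ] (z ∈ elems S × col z ≡ c × (z ≡ x₀ ⊎ c ≢ col x₀))
      columnRep c with c ≟ᶠ col x₀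
      ... | yes refl = x₀ , x₀∈ , refl , inj₁ refl
      ... | no c≢ with twoDistinct⇒avoiding _≟_ (dom (row x₀ , c)) x₀
      ...   | z , z∈ , adj , z≢x₀ = z , z∈ , sym (offRow⇒sameCol (offRow z∈ z≢x₀) adj) , inj₂ c≢

      rep : Fin m → Cell
      rep c = proj₁ (columnRep c)

      col-rep : ∀ c → col (rep c) ≡ c
      col-rep c = proj₁ (proj₂ (proj₂ (columnRep c)))

      rep-injective : Injective _≡_ _≡_ rep
      rep-injective {c} {c′} eq = trans (sym (col-rep c)) (trans (cong col eq) (col-rep c′))

      notRep : ∀ {w} → w ≢ x₀ × col w ≡ col x₀ → ∀ c → w ≢ rep c
      notRep (w≢x₀ , wc) c eq with proj₂ (proj₂ (proj₂ (columnRep c)))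
      ... | inj₁ rep≡x₀ = w≢x₀ (trans eq rep≡x₀)
      ... | inj₂ c≢ = c≢ (trans (sym (col-rep c)) (trans (cong col (sym eq)) wc))

      cells-unique : Unique (a ∷ b ∷ tabulate rep)
      cells-unique =
        (a≢b ∷ All-tabulate⁺ (notRep (neighbour-inColumn a∈ adj-a))) ∷
        All-tabulate⁺ (notRep (neighbour-inColumn b∈ adj-b)) ∷
        Unique.tabulate⁺ rep-injective

      cells⊆S : ∀ {z} → z ∈ a ∷ b ∷ tabulate rep → z ∈ elems S
      cells⊆S (here refl) = a∈
      cells⊆S (there (here refl)) = b∈
      cells⊆S (there (there z∈)) with ∈-tabulate⁻ z∈
      ... | c , refl = proj₁ (proj₂ (columnRep c))

    sparseRow⇒2+m≤card : ∀ r → 2 ≤ m → ¬ TwoDistinctIn (elems S) (λ y → row y ≡ r) → 2 + m ≤ card S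
    sparseRow⇒2+m≤card r 2≤m ¬two with any? (λ y → row y ≟ᶠ r) (elems S)
    ... | no noneInRow =
      ≤-trans (+-monoˡ-≤ m 2≤m) (emptyRow⇒m+m≤card r (λ y∈ ry → noneInRow (lose y∈ ry)))
    ... | yes someInRow with find someInRow
    ...   | x₀ , x₀∈ , rx₀ = singletonRow⇒2+m≤card x₀∈ rx₀ only-x₀
      where
      only-x₀ : ∀ {y} → y ∈ elems S → row y ≡ r → y ≡ x₀
      only-x₀ {y} y∈ ry with y ≟ x₀
      ... | yes y≡x₀ = y≡x₀
      ... | no y≢x₀ = ⊥-elim (¬two (y , x₀ , y∈ , x₀∈ , y≢x₀ , ry , rx₀))

    twoInRow? : ∀ r → Dec (TwoDistinctIn (elems S) (λ y → row y ≡ r))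
    twoInRow? r = twoDistinctIn? _≟_ (λ y → row y ≟ᶠ r) (elems S)

    min+2≤card : 2 ≤ n → 2 ≤ m → n ⊓ m + 2 ≤ card S
    min+2≤card 2≤n 2≤m with all? twoInRow?
    ... | yes twoPerRow = begin
      n ⊓ m + 2 ≤⟨ +-monoˡ-≤ 2 (m⊓n≤m n m) ⟩
      n + 2     ≤⟨ +-monoʳ-≤ n 2≤n ⟩
      n + n     ≤⟨ twoPerClass⇒≤length row twoPerRow ⟩
      card S    ∎
      where open ≤-Reasoning
    ... | no ¬twoPerRow with ¬∀⟶∃¬ n _ twoInRow? ¬twoPerRow
    ...   | r , ¬two = begin
      n ⊓ m + 2 ≤⟨ +-monoˡ-≤ 2 (m⊓n≤n n m) ⟩
      m + 2     ≡⟨ +-comm m 2 ⟩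
      2 + m     ≤⟨ sparseRow⇒2+m≤card r 2≤m ¬two ⟩
      card S    ∎
      where open ≤-Reasoning

inColumn₀ inColumn₁ : ∀ {n m} → Fin n → Fin n × Fin (2 + m)
inColumn₀ i = i , zero
inColumn₁ i = i , suc zero

twoColumns : ∀ n m → VSet (Fin n × Fin (2 + m))
twoColumns n m = vset (tabulate inColumn₀ ++ tabulate inColumn₁)
  (unique-tabulate++tabulate (cong proj₁) (cong proj₁) (λ _ _ ()))

card-twoColumns : ∀ n m → card (twoColumns n m) ≡ n + n
card-twoColumns n m = length-tabulate++tabulate (inColumn₀ {n} {m}) inColumn₁

module _ {n m : ℕ} where

  inColumn₀∈twoColumns : ∀ i → inColumn₀ i ∈ elems (twoColumns n m)
  inColumn₀∈twoColumns i = ∈-++⁺ˡ (∈-tabulate⁺ i)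

  inColumn₁∈twoColumns : ∀ i → inColumn₁ i ∈ elems (twoColumns n m)
  inColumn₁∈twoColumns i = ∈-++⁺ʳ (tabulate inColumn₀) (∈-tabulate⁺ i)

twoColumns-total2Dom : ∀ n m → IsTotal2Dom (K (2 + n) □ K (2 + m)) (twoColumns (2 + n) m)
twoColumns-total2Dom n m (i , zero) =
  inColumn₁ i , inColumn₀ (punchIn i zero) , inColumn₁∈twoColumns i , inColumn₀∈twoColumns (punchIn i zero) ,
  (λ ()) , inj₁ (refl , λ ()) , inj₂ (refl , punchInᵢ≢i i zero ∘ sym)
twoColumns-total2Dom n m (i , suc zero) =
  inColumn₀ i , inColumn₁ (punchIn i zero) , inColumn₀∈twoColumns i , inColumn₁∈twoColumns (punchIn i zero) ,
  (λ ()) , inj₁ (refl , λ ()) , inj₂ (refl , punchInᵢ≢i i zero ∘ sym)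
twoColumns-total2Dom n m (i , suc (suc j)) =
  inColumn₀ i , inColumn₁ i , inColumn₀∈twoColumns i , inColumn₁∈twoColumns i ,
  (λ ()) , inj₁ (refl , λ ()) , inj₁ (refl , λ ())

n+n≡2*n : ∀ n → n + n ≡ 2 * n
n+n≡2*n n = cong (n +_) (sym (+-identityʳ n))

total2DomSet-of-size-2*min : ∀ n m → 2 ≤ n → 2 ≤ m →
  ∃[ S ] (IsTotal2Dom (K n □ K m) S × card S ≡ 2 * (n ⊓ m))
total2DomSet-of-size-2*min n m (s≤s (s≤s {n = n′} _)) (s≤s (s≤s {n = m′} _)) with n ≤? m
... | yes n≤m = twoColumns n m′ , twoColumns-total2Dom n′ m′ , (begin
  card (twoColumns n m′) ≡⟨ card-twoColumns n m′ ⟩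
  n + n                   ≡⟨ n+n≡2*n n ⟩
  2 * n                   ≡⟨ cong (2 *_) (m≤n⇒m⊓n≡m n≤m) ⟨
  2 * (n ⊓ m)             ∎)
  where open ≡-Reasoning
... | no n≰m =
  swapVSet (twoColumns m n′) , IsTotal2Dom-swap (K m) (K n) (twoColumns m n′) (twoColumns-total2Dom m′ n′) , (begin
  card (swapVSet (twoColumns m n′)) ≡⟨ length-map swap (elems (twoColumns m n′)) ⟩
  card (twoColumns m n′)            ≡⟨ card-twoColumns m n′ ⟩
  m + m                              ≡⟨ n+n≡2*n m ⟩
  2 * m                              ≡⟨ cong (2 *_) (m≥n⇒m⊓n≡n (≰⇒≥ n≰m)) ⟨
  2 * (n ⊓ m)                        ∎)
  where open ≡-Reasoning

lemma2p1 : (n m : ℕ) → 2 ≤ n → 2 ≤ m →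
    ∃[ k ] (IsTotal2DomNumber (K n □ K m) k × (n ⊓ m) + 2 ≤ k × k ≤ 2 * (n ⊓ m))
lemma2p1 n m 2≤n 2≤m with total2DomSet-of-size-2*min n m 2≤n 2≤m
... | S₀ , dom₀ , card₀ with Rook.total2DomNumber-exists n m S₀ dom₀
...   | k , (S , dom , cardS) , minimal =
  k , ((S , dom , cardS) , minimal) ,
  subst (n ⊓ m + 2 ≤_) cardS (Rook.LowerBound.min+2≤card n m S dom 2≤n 2≤m) ,
  subst (k ≤_) card₀ (minimal S₀ dom₀)
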